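{- Let $G=(V,E,\omega)$ be a weighted undirected graph with positive edge weights in which every pair of vertices is joined by a unique shortest path, and let $k$ be the skeleton dimension of $G$. Let $\rho:V\to[0,1]$ be injective. For $u\in V$ and $D>0$ define $$R^{(D)}(u)=\bigcup_{v\in V:\ d_G(u,v)\ge D}\Big\{\operatorname{argmin}_{r\in P_{uv},\ d_G(u,r)\in[D/4,D/2]}\rho(r)\Big\}$$ (where a term with an empty range of minimization contributes nothing). Then for every $u\in V$ and every $D>0$, $|R^{(D)}(u)|\le k$.
   Context: $d_G$ denotes the shortest-path distance in $G$ and $P_{uv}$ the unique shortest $u$–$v$ path (as a set of vertices). Skeleton dimension: for $u\in V$, let $T_u$ be the shortest-path tree of $u$ (the union of the paths $P_{uv}$, $v\in V$), directed from the root $u$ to the leaves, and let $\widetilde T_u$ be its geometric realization, i.e., the continuous tree in which every edge of length $\ell$ is viewed as a segment of length $\ell$ consisting of infinitely many points. For a point $v$ of $\widetilde T_u$, its reach is $\mathrm{reach}(v)=\max_{x: v\in P_{ux}} d_{\widetilde T_u}(v,x)$. The skeleton $\widetilde T^*_u$ is the subtree of $\widetilde T_u$ induced by the points $v$ with $\mathrm{reach}(v)\ge \frac12 d_{\widetilde T_u}(u,v)$. The skeleton dimension is $k=\max_{u\in V}\max_{r>0}|\mathrm{cut}_r(\widetilde T^*_u)|$, where $\mathrm{cut}_r(\widetilde T^*_u)$ is the set of points of $\widetilde T^*_u$ at distance exactly $r$ from $u$.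
   Formalization: The edge weights are positive rationals, and ρ, the parameter D and the radii r in the definition of the skeleton dimension all take rational values. -}

module Defs where

open import Data.Nat using (ℕ)
open import Data.Bool using (Bool; true; false; T)
open import Data.Fin using (Fin)
open import Data.List using (List; []; _∷_; _++_; [_]; length)
open import Data.List.Membership.Propositional using (_∈_)
open import Data.List.Relation.Unary.All using (All)
open import Data.List.Relation.Unary.Unique.Propositional using (Unique)
open import Data.Integer using (+_)
open import Data.Rational using (ℚ; 0ℚ; 1ℚ; ½; _+_; _*_; _≤_; _<_; _/_)
open import Data.Product using (Σ; ∃; ∃-syntax; _×_; proj₁)
open import Data.Unit using (⊤)
open import Relation.Binary.PropositionalEquality using (_≡_)
open import Function.Definitions using (Injective)

record WGraph (n : ℕ) : Set where
  field
    adj       : Fin n → Fin n → Bool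
    wt        : Fin n → Fin n → ℚ
    adj-sym   : ∀ x y → adj x y ≡ adj y x
    adj-irr   : ∀ x → adj x x ≡ false
    wt-sym    : ∀ x y → wt x y ≡ wt y x
    wt-pos    : ∀ x y → T (adj x y) → 0ℚ < wt x y

module _ {n : ℕ} (G : WGraph n) where
  open WGraph G

  -- A walk is a start vertex x together with the list of the following
  -- vertices; IsWalk x xs says consecutive vertices of x ∷ xs are adjacent.
  IsWalk : Fin n → List (Fin n) → Set
  IsWalk x []       = ⊤
  IsWalk x (y ∷ ys) = T (adj x y) × IsWalk y ys

  lastV : Fin n → List (Fin n) → Fin n
  lastV x []       = x
  lastV x (y ∷ ys) = lastV y ys

  len : Fin n → List (Fin n) → ℚ
  len x []       = 0ℚ
  len x (y ∷ ys) = wt x y + len y ys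

  WalkFromTo : Fin n → Fin n → List (Fin n) → Set
  WalkFromTo u v xs = IsWalk u xs × lastV u xs ≡ v

  IsShortest : Fin n → Fin n → List (Fin n) → Set
  IsShortest u v xs =
    WalkFromTo u v xs × (∀ ys → WalkFromTo u v ys → len u xs ≤ len u ys)

  UniqueShortestPaths : Set
  UniqueShortestPaths =
    ∀ u v → Σ (List (Fin n)) λ xs →
      IsShortest u v xs × (∀ ys → IsShortest u v ys → ys ≡ xs)

-- |S| ≤ k for a subset S of Fin n: every duplicate-free list of elements of S
-- has length at most k.
AtMost : {n : ℕ} → ℕ → (Fin n → Set) → Set
AtMost {n} k S = ∀ (l : List (Fin n)) → Unique l → All S l → length l Data.Nat.≤ k

-- |S| ≡ k witnessed (together with AtMost k S this means |S| = k)
HasAtLeast : {n : ℕ} → ℕ → (Fin n → Set) → Set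
HasAtLeast {n} k S = Σ (List (Fin n)) λ l → Unique l × All S l × length l ≡ k

module WithUSP {n : ℕ} (G : WGraph n) (usp : UniqueShortestPaths G) where
  open WGraph G

  tail : Fin n → Fin n → List (Fin n)
  tail u v = proj₁ (usp u v)

  P : Fin n → Fin n → List (Fin n)
  P u v = u ∷ tail u v

  d : Fin n → Fin n → ℚ
  d u v = len G u (tail u v)

  -- Points of the geometric realization of T_u at distance r > 0 from u.
  -- Such a point lies on a unique tree edge (a , b) of T_u, a the parent of b,
  -- with d(u,a) < r ≤ d(u,b) (r = d(u,b) is the vertex b itself).  We name the
  -- point by b.
  PointOn : Fin n → Fin n → ℚ → Fin n → Set
  PointOn u x r b = ∃[ ys ] ∃[ zs ]
    (tail u x ≡ ys ++ (b ∷ zs)) × (len G u ys < r) × (r ≤ len G u (ys ++ [ b ]))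

  -- b names a point of cut_r of the skeleton T*_u: the point v at distance r
  -- with reach(v) = max { len(P_ux) - r | v ∈ P_ux } ≥ r / 2.
  InSkeletonCut : Fin n → ℚ → Fin n → Set
  InSkeletonCut u r b = ∃[ x ] PointOn u x r b × (r + ½ * r ≤ len G u (tail u x))

  IsSkeletonDimension : ℕ → Set
  IsSkeletonDimension k =
    (∀ u r → 0ℚ < r → AtMost k (InSkeletonCut u r))
    × (∃[ u ] ∃[ r ] (0ℚ < r × HasAtLeast k (InSkeletonCut u r)))

  ¼ : ℚ
  ¼ = + 1 / 4

  InR : (Fin n → ℚ) → ℚ → Fin n → Fin n → Set
  InR ρ D u m = ∃[ v ]
    (D ≤ d u v) × (m ∈ P u v) × (¼ * D ≤ d u m) × (d u m ≤ ½ * D)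
    × (∀ r → r ∈ P u v → ¼ * D ≤ d u r → d u r ≤ ½ * D → ρ m ≤ ρ r)

{-# OPTIONS --safe #-}
-- Send each m ∈ R^(D)(u), witnessed by a path P_uv with d(u,v) ≥ D, to the point b
-- of P_uv at distance D/2 from u.  Since d(u,v) ≥ 3/2 · D/2, b lies in the skeleton
-- cut at radius D/2, and this assignment is injective: the part of P_uv up to b is
-- the shortest path P_ub, which contains m (as d(u,m) ≤ D/2) and is shared by every
-- path through b.  Two elements sent to the same b thus lie in each other's
-- minimisation range, so they have the same ρ-value and coincide.
module Submission where

open import Defs
open import Data.Nat using (ℕ) renaming (_≤_ to _≤ℕ_)
open import Data.Fin using (Fin)
open import Data.Rational using (ℚ; 0ℚ; 1ℚ; _≤_; _<_; ½; _+_; _*_; _≤?_; nonNegative)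
open import Data.Rational.Properties
open import Data.Product using (Σ; ∃; ∃-syntax; _×_; proj₁; proj₂; _,_)
open import Relation.Binary.PropositionalEquality
  using (_≡_; _≢_; refl; sym; trans; cong; subst; subst₂)
open import Function.Definitions using (Injective)
open import Data.Empty using (⊥-elim)
open import Data.List using (List; []; _∷_; _++_; [_])
open import Data.List.Properties using (++-assoc)
open import Data.List.Membership.Propositional using (_∈_)
open import Data.List.Membership.Propositional.Properties using (∈-∃++; ∈-++⁻)
open import Data.List.Relation.Binary.Pointwise using (Pointwise; []; _∷_; Pointwise-length)
open import Data.List.Relation.Binary.Subset.Propositional using (_⊆_)
open import Data.List.Relation.Binary.Subset.Propositional.Properties using (xs⊆xs++ys; ∷⁺ʳ)
open import Data.List.Relation.Unary.All as All using (All; []; _∷_)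
open import Data.List.Relation.Unary.Any using (here; there)
open import Data.List.Relation.Unary.AllPairs using ([]; _∷_)
open import Data.List.Relation.Unary.Unique.Propositional using (Unique)
open import Data.Sum using (inj₁; inj₂)
open import Data.Unit using (tt)
open import Relation.Nullary using (yes; no)
open import Relation.Nullary.Decidable using (from-yes)

module _ {A B : Set} {R : A → B → Set} where

  Pointwise-choice : ∀ {xs} → All (λ x → ∃ (R x)) xs → ∃ (Pointwise R xs)
  Pointwise-choice []               = [] , []
  Pointwise-choice ((y , xRy) ∷ ps) =
    let ys , xsRys = Pointwise-choice ps in y ∷ ys , xRy ∷ xsRys

  Pointwise-All : ∀ {T : B → Set} {xs ys} → (∀ {x y} → R x y → T y) →
                  Pointwise R xs ys → All T ys
  Pointwise-All R⇒T []             = []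
  Pointwise-All R⇒T (xRy ∷ xsRys) = R⇒T xRy ∷ Pointwise-All R⇒T xsRys

  module _ (R-injective : ∀ {x x′ y} → R x y → R x′ y → x ≡ x′) where

    Pointwise-All-≢ : ∀ {x y xs ys} → R x y → Pointwise R xs ys →
                      All (x ≢_) xs → All (y ≢_) ys
    Pointwise-All-≢ xRy []               []            = []
    Pointwise-All-≢ xRy (x′Ry′ ∷ xsRys) (x≢x′ ∷ x≢xs) =
      (λ { refl → x≢x′ (R-injective xRy x′Ry′) }) ∷ Pointwise-All-≢ xRy xsRys x≢xs

    Pointwise-Unique : ∀ {xs ys} → Pointwise R xs ys → Unique xs → Unique ys
    Pointwise-Unique []             []                 = []
    Pointwise-Unique (xRy ∷ xsRys) (x≢xs ∷ unique-xs) =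
      Pointwise-All-≢ xRy xsRys x≢xs ∷ Pointwise-Unique xsRys unique-xs

AtMost-injectiveRelation : ∀ {n k} {S T : Fin n → Set} (R : Fin n → Fin n → Set) →
  (∀ {a a′ b} → R a b → R a′ b → a ≡ a′) →
  (∀ {a} → S a → ∃ (R a)) → (∀ {a b} → R a b → T b) →
  AtMost k T → AtMost k S
AtMost-injectiveRelation {k = k} R R-injective S⇒R R⇒T T≤k l unique-l all-S =
  subst (_≤ℕ k) (sym (Pointwise-length lRl′))
    (T≤k l′ (Pointwise-Unique R-injective lRl′ unique-l) (Pointwise-All R⇒T lRl′))
  where
  l′ = proj₁ (Pointwise-choice (All.map S⇒R all-S))
  lRl′ = proj₂ (Pointwise-choice (All.map S⇒R all-S))

+-cancelʳ-≤ : ∀ c {a b} → a + c ≤ b + c → a ≤ b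
+-cancelʳ-≤ c a+c≤b+c = ≮⇒≥ λ b<a → <-irrefl refl (<-≤-trans (+-monoˡ-< c b<a) a+c≤b+c)

*-≤-self : ∀ {q} p → 0ℚ ≤ p → q ≤ 1ℚ → q * p ≤ p
*-≤-self {q} p 0≤p q≤1 = subst (q * p ≤_) (*-identityˡ p) (*-monoʳ-≤-nonNeg p {{nonNegative 0≤p}} q≤1)

0<½*p : ∀ {p} → 0ℚ < p → 0ℚ < ½ * p
0<½*p {p} 0<p = subst (_< ½ * p) (*-zeroʳ ½) (*-monoʳ-<-pos ½ 0<p)

½*p≤p : ∀ {p} → 0ℚ ≤ p → ½ * p ≤ p
½*p≤p 0≤p = *-≤-self _ 0≤p (from-yes (½ ≤? 1ℚ))

½*p+¼*p≤p : ∀ {p} → 0ℚ ≤ p → ½ * p + ½ * (½ * p) ≤ p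
½*p+¼*p≤p {p} 0≤p = subst (_≤ p) ¾*p≡ (*-≤-self p 0≤p (from-yes ((½ + ½ * ½) ≤? 1ℚ)))
  where
  ¾*p≡ : (½ + ½ * ½) * p ≡ ½ * p + ½ * (½ * p)
  ¾*p≡ = trans (*-distribʳ-+ p ½ (½ * ½)) (cong (½ * p +_) (*-assoc ½ ½ p))

module Walks {n : ℕ} (G : WGraph n) where
  open WGraph G

  lastV-++ : ∀ x xs ys → lastV G x (xs ++ ys) ≡ lastV G (lastV G x xs) ys
  lastV-++ x []       ys = refl
  lastV-++ x (y ∷ xs) ys = lastV-++ y xs ys

  len-++ : ∀ {x y} xs ys → lastV G x xs ≡ y → len G x (xs ++ ys) ≡ len G x xs + len G y ys
  len-++         []       ys refl = sym (+-identityˡ _)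
  len-++ {x = x} (z ∷ xs) ys eq   =
    trans (cong (wt x z +_) (len-++ xs ys eq)) (sym (+-assoc (wt x z) _ _))

  IsWalk-++⁻ : ∀ {x} xs {ys} → IsWalk G x (xs ++ ys) → IsWalk G x xs × IsWalk G (lastV G x xs) ys
  IsWalk-++⁻ []       w         = tt , w
  IsWalk-++⁻ (y ∷ xs) (x~y , w) = let w₁ , w₂ = IsWalk-++⁻ xs w in (x~y , w₁) , w₂

  IsWalk-++⁺ : ∀ {x} xs {ys} → IsWalk G x xs → IsWalk G (lastV G x xs) ys → IsWalk G x (xs ++ ys)
  IsWalk-++⁺ []       _          w₂ = w₂
  IsWalk-++⁺ (y ∷ xs) (x~y , w₁) w₂ = x~y , IsWalk-++⁺ xs w₁ w₂

  WalkFromTo-++ : ∀ {x y z} xs {ys} → WalkFromTo G x y xs → WalkFromTo G y z ys →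
                  WalkFromTo G x z (xs ++ ys)
  WalkFromTo-++ {x} xs {ys} (xs-walk , refl) (ys-walk , refl) =
    IsWalk-++⁺ xs xs-walk ys-walk , lastV-++ x xs ys

  WalkFromTo-++⁻ : ∀ {x z} xs {ys} → WalkFromTo G x z (xs ++ ys) →
                   WalkFromTo G x (lastV G x xs) xs × WalkFromTo G (lastV G x xs) z ys
  WalkFromTo-++⁻ {x} xs {ys} (xsys-walk , refl) =
    (proj₁ (IsWalk-++⁻ xs xsys-walk) , refl) , proj₂ (IsWalk-++⁻ xs xsys-walk) , sym (lastV-++ x xs ys)

  len-nonneg : ∀ x xs → IsWalk G x xs → 0ℚ ≤ len G x xs
  len-nonneg x []       _         = ≤-refl
  len-nonneg x (y ∷ xs) (x~y , w) =
    subst (_≤ wt x y + len G y xs) (+-identityʳ 0ℚ)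
      (+-mono-≤ (<⇒≤ (wt-pos x y x~y)) (len-nonneg y xs w))

  len-snoc-pos : ∀ x xs y → IsWalk G x (xs ++ [ y ]) → 0ℚ < len G x (xs ++ [ y ])
  len-snoc-pos x []       y (x~y , _) =
    subst (0ℚ <_) (sym (+-identityʳ (wt x y))) (wt-pos x y x~y)
  len-snoc-pos x (z ∷ xs) y (x~z , w) =
    subst (_< wt x z + len G z (xs ++ [ y ])) (+-identityʳ 0ℚ)
      (+-mono-<-≤ (wt-pos x z x~z) (len-nonneg z (xs ++ [ y ]) w))

  -- The offset c makes the statement inductive along the walk.
  crossing : ∀ x xs {c r} → c < r → r ≤ c + len G x xs →
    ∃[ ys ] ∃[ b ] ∃[ zs ]
      (xs ≡ ys ++ b ∷ zs) × (c + len G x ys < r) × (r ≤ c + len G x (ys ++ [ b ]))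
  crossing x [] {c} {r} c<r r≤c+0 =
    ⊥-elim (<-irrefl refl (<-≤-trans c<r (subst (r ≤_) (+-identityʳ c) r≤c+0)))
  crossing x (y ∷ xs) {c} {r} c<r r≤ with r ≤? c + len G x [ y ]
  ... | yes r≤c+xy = [] , y , xs , refl , subst (_< r) (sym (+-identityʳ c)) c<r , r≤c+xy
  ... | no r≰c+xy
    with ys , b , zs , refl , below , above ← crossing y xs {c + wt x y} {r}
           (subst (λ w → c + w < r) (+-identityʳ (wt x y)) (≰⇒> r≰c+xy))
           (subst (r ≤_) (sym (+-assoc c (wt x y) (len G y xs))) r≤)
    = y ∷ ys , b , zs , refl ,
      subst (_< r) (+-assoc c (wt x y) (len G y ys)) below ,
      subst (r ≤_) (+-assoc c (wt x y) (len G y (ys ++ [ b ]))) above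

module ShortestPaths {n : ℕ} (G : WGraph n) (usp : UniqueShortestPaths G) where
  open WGraph G
  open WithUSP G usp
  open Walks G

  tail-walk : ∀ u v → WalkFromTo G u v (tail u v)
  tail-walk u v = proj₁ (proj₁ (proj₂ (usp u v)))

  tail-minimal : ∀ u v ys → WalkFromTo G u v ys → d u v ≤ len G u ys
  tail-minimal u v = proj₂ (proj₁ (proj₂ (usp u v)))

  tail-unique : ∀ u v ys → IsShortest G u v ys → ys ≡ tail u v
  tail-unique u v = proj₂ (proj₂ (usp u v))

  -- Exchanging the prefix for a shorter walk to w would give a shorter walk to v.
  tail-prefix : ∀ {u v w} as cs → tail u v ≡ as ++ cs → lastV G u as ≡ w → tail u w ≡ as
  tail-prefix {u} {v} {w} as cs tail≡ refl =
    sym (tail-unique u w as (as-walk , as-minimal))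
    where
    as-walk : WalkFromTo G u w as
    as-walk = proj₁ (WalkFromTo-++⁻ as (subst (WalkFromTo G u v) tail≡ (tail-walk u v)))

    cs-walk : WalkFromTo G w v cs
    cs-walk = proj₂ (WalkFromTo-++⁻ as (subst (WalkFromTo G u v) tail≡ (tail-walk u v)))

    as-minimal : ∀ ws → WalkFromTo G u w ws → len G u as ≤ len G u ws
    as-minimal ws ws-walk = +-cancelʳ-≤ (len G w cs) (begin
      len G u as + len G w cs  ≡⟨ sym (len-++ as cs refl) ⟩
      len G u (as ++ cs)       ≡⟨ cong (len G u) (sym tail≡) ⟩
      d u v                    ≤⟨ tail-minimal u v (ws ++ cs) (WalkFromTo-++ ws ws-walk cs-walk) ⟩
      len G u (ws ++ cs)       ≡⟨ len-++ ws cs (proj₂ ws-walk) ⟩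
      len G u ws + len G w cs  ∎)
      where open ≤-Reasoning

  d-beyond-prefix : ∀ {u v m} as cs → tail u v ≡ as ++ cs → m ∈ cs → len G u as < d u m
  d-beyond-prefix {u} {m = m} as cs tail≡ m∈cs
    with zs , zs′ , refl ← ∈-∃++ m∈cs = begin-strict
      len G u as                                      ≡⟨ sym (+-identityʳ _) ⟩
      len G u as + 0ℚ                                 <⟨ +-monoʳ-< (len G u as) (len-snoc-pos _ zs m zs-walk) ⟩
      len G u as + len G (lastV G u as) (zs ++ [ m ]) ≡⟨ sym (len-++ as (zs ++ [ m ]) refl) ⟩
      len G u (as ++ zs ++ [ m ])                     ≡⟨ cong (len G u) (sym tail-m) ⟩
      d u m                                           ∎
    where
    open ≤-Reasoning
    tail-m : tail u m ≡ as ++ zs ++ [ m ]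
    tail-m = tail-prefix (as ++ zs ++ [ m ]) zs′
      (trans tail≡ (sym (trans (++-assoc as (zs ++ [ m ]) zs′) (cong (as ++_) (++-assoc zs [ m ] zs′)))))
      (trans (lastV-++ u as (zs ++ [ m ])) (lastV-++ (lastV G u as) zs [ m ]))
    zs-walk : IsWalk G (lastV G u as) (zs ++ [ m ])
    zs-walk = proj₂ (IsWalk-++⁻ as (subst (IsWalk G u) tail-m (proj₁ (tail-walk u m))))

  ∈-P-prefix : ∀ {u v m} as cs → tail u v ≡ as ++ cs → m ∈ P u v → d u m ≤ len G u as → m ∈ u ∷ as
  ∈-P-prefix           as cs tail≡ (here m≡u)     _     = here m≡u
  ∈-P-prefix {m = m} as cs tail≡ (there m∈tail) dm≤as with ∈-++⁻ as (subst (m ∈_) tail≡ m∈tail)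
  ... | inj₁ m∈as = there m∈as
  ... | inj₂ m∈cs = ⊥-elim (<-irrefl refl (<-≤-trans (d-beyond-prefix as cs tail≡ m∈cs) dm≤as))

  private
    regroup : ∀ {xs : List (Fin n)} ys b zs → xs ≡ ys ++ b ∷ zs → xs ≡ (ys ++ [ b ]) ++ zs
    regroup ys b zs xs≡ = trans xs≡ (sym (++-assoc ys [ b ] zs))

  tail-through : ∀ {u x} ys b zs → tail u x ≡ ys ++ b ∷ zs → tail u b ≡ ys ++ [ b ]
  tail-through {u} ys b zs tail≡ =
    tail-prefix (ys ++ [ b ]) zs (regroup ys b zs tail≡) (lastV-++ u ys [ b ])

  P-point-⊆ : ∀ {u x r b} → PointOn u x r b → P u b ⊆ P u x
  P-point-⊆ {u} {b = b} (ys , zs , tail≡ , _) =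
    subst₂ _⊆_ (cong (u ∷_) (sym (tail-through ys b zs tail≡)))
               (cong (u ∷_) (sym (regroup ys b zs tail≡)))
               (∷⁺ʳ u (xs⊆xs++ys (ys ++ [ b ]) zs))

  ∈-P-point : ∀ {u x r b m} → PointOn u x r b → m ∈ P u x → d u m ≤ r → m ∈ P u b
  ∈-P-point {u} {b = b} {m} (ys , zs , tail≡ , _ , r≤) m∈Pux dm≤r =
    subst (m ∈_) (cong (u ∷_) (sym (tail-through ys b zs tail≡)))
      (∈-P-prefix (ys ++ [ b ]) zs (regroup ys b zs tail≡) m∈Pux (≤-trans dm≤r r≤))

  PointOn-exists : ∀ {u x r} → 0ℚ < r → r ≤ d u x → ∃ (PointOn u x r)
  PointOn-exists {u} {x} {r} 0<r r≤dux
    with ys , b , zs , tail≡ , below , above ←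
           crossing u (tail u x) 0<r (subst (r ≤_) (sym (+-identityˡ _)) r≤dux)
    = b , ys , zs , tail≡ , subst (_< r) (+-identityˡ _) below , subst (r ≤_) (+-identityˡ _) above

module HalfwayPoint {n : ℕ} (G : WGraph n) (usp : UniqueShortestPaths G)
                   (ρ : Fin n → ℚ) (u : Fin n) (D : ℚ) where
  open WithUSP G usp
  open ShortestPaths G usp

  InR-via : Fin n → Fin n → Set
  InR-via m b = Σ (InR ρ D u m) λ m∈R → PointOn u (proj₁ m∈R) (½ * D) b

  module _ (0<D : 0ℚ < D) where

    InR⇒InR-via : ∀ {m} → InR ρ D u m → ∃ (InR-via m)
    InR⇒InR-via m∈R@(v , D≤duv , _) =
      let b , b-on-v = PointOn-exists (0<½*p 0<D) (≤-trans (½*p≤p (<⇒≤ 0<D)) D≤duv)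
      in  b , m∈R , b-on-v

    InR-via⇒InSkeletonCut : ∀ {m b} → InR-via m b → InSkeletonCut u (½ * D) b
    InR-via⇒InSkeletonCut ((v , D≤duv , _) , b-on-v) =
      v , b-on-v , ≤-trans (½*p+¼*p≤p (<⇒≤ 0<D)) D≤duv

  -- m lies on P_ub, the common prefix of all witnessing paths through b, so it
  -- competes in the minimisation defining any m′ sent to b.
  InR-via-∈-P : ∀ {m b v} → InR-via m b → PointOn u v (½ * D) b → m ∈ P u v
  InR-via-∈-P ((_ , _ , m∈Puv , _ , dum≤½D , _) , b-on-v) b-on-v′ =
    P-point-⊆ b-on-v′ (∈-P-point b-on-v m∈Puv dum≤½D)

  InR-via-injective : Injective _≡_ _≡_ ρ → ∀ {m m′ b} → InR-via m b → InR-via m′ b → m ≡ m′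
  InR-via-injective ρ-injective {m} {m′}
    via@((_ , _ , _ , ¼D≤dum , dum≤½D , m-minimal) , b-on-v)
    via′@((_ , _ , _ , ¼D≤dum′ , dum′≤½D , m′-minimal) , b-on-v′) =
    ρ-injective (≤-antisym (m-minimal m′ (InR-via-∈-P via′ b-on-v) ¼D≤dum′ dum′≤½D)
                           (m′-minimal m (InR-via-∈-P via b-on-v′) ¼D≤dum dum≤½D))

mainTheorem2 : {n : ℕ} (G : WGraph n) (usp : UniqueShortestPaths G) (k : ℕ)
    → WithUSP.IsSkeletonDimension G usp k
    → (ρ : Fin n → ℚ) → (∀ x → 0ℚ ≤ ρ x × ρ x ≤ 1ℚ) → Injective _≡_ _≡_ ρ
    → ∀ (u : Fin n) (D : ℚ) → 0ℚ < D
    → AtMost k (WithUSP.InR G usp ρ D u)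
-- Only the injectivity of ρ matters, not its range [0,1].
mainTheorem2 G usp _ (cut-bound , _) ρ _ ρ-injective u D 0<D =
  AtMost-injectiveRelation InR-via (InR-via-injective ρ-injective)
    (InR⇒InR-via 0<D) (InR-via⇒InSkeletonCut 0<D) (cut-bound u (½ * D) (0<½*p 0<D))
  where open HalfwayPoint G usp ρ u D
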